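{- Let $r\ge2$, $p\ge1$ and $m\ge2$ be integers with $(r-2)^{m-2}\ge p-1$. Then \[\operatorname{forb}\big(m,r,p\cdot\left[\begin{smallmatrix}0\\1\end{smallmatrix}\right]\big)=2(r-1)^m-(r-2)^m+(p-1)m(m-1).\]
   Context: An $r$-matrix is a matrix with entries in $\{0,1,\dots,r-1\}$. A matrix is simple if it has no repeated columns. For matrices $F$ and $A$, $A$ avoids $F$ if no submatrix of $A$ is a row and column permutation of $F$. $\operatorname{forb}(m,r,F)$ is the maximum number of columns of a simple $m$-rowed $r$-matrix that avoids $F$. $p\cdot\left[\begin{smallmatrix}0\\1\end{smallmatrix}\right]$ is the $2\times p$ matrix all of whose columns equal $\left[\begin{smallmatrix}0\\1\end{smallmatrix}\right]$. Convention: $0^0=1$. -}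

module Defs where

open import Data.Nat using (ℕ; zero; suc; _≤_)
open import Data.Fin using (Fin; toℕ)
open import Data.Product using (Σ; _×_; ∃)
open import Relation.Binary.PropositionalEquality using (_≡_)
open import Relation.Nullary using (¬_)
open import Function.Definitions using (Injective)

RMatrix : ℕ → ℕ → ℕ → Set
RMatrix m r n = Fin m → Fin n → Fin r

Simple : ∀ {m r n} → RMatrix m r n → Set
Simple {m} {r} {n} A = (j j′ : Fin n) → ((i : Fin m) → A i j ≡ A i j′) → j ≡ j′

-- A contains F iff some submatrix of A is a row and column permutation of F,
-- i.e. there are injective row / column selections ρ, γ with A (ρ i) (γ j) = F i j.
Contains : ∀ {m r n k l} → (Fin k → Fin l → ℕ) → RMatrix m r n → Set
Contains {m} {r} {n} {k} {l} F A =
  Σ (Fin k → Fin m) λ ρ → Σ (Fin l → Fin n) λ γ →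
    Injective _≡_ _≡_ ρ × Injective _≡_ _≡_ γ ×
    ((i : Fin k) (j : Fin l) → toℕ (A (ρ i) (γ j)) ≡ F i j)

Avoids : ∀ {m r n k l} → (Fin k → Fin l → ℕ) → RMatrix m r n → Set
Avoids F A = ¬ Contains F A

IsForb : ∀ {k l} → ℕ → ℕ → (Fin k → Fin l → ℕ) → ℕ → Set
IsForb m r F N =
  (Σ (RMatrix m r N) λ A → Simple A × Avoids F A) ×
  ((n : ℕ) (A : RMatrix m r n) → Simple A → Avoids F A → n ≤ N)

-- p · [0;1] : the 2 × p matrix all of whose columns are [0;1].
pCopies01 : (p : ℕ) → Fin 2 → Fin p → ℕ
pCopies01 p i j = toℕ i

-- Write p = p′+1.  Every column is either one-sided (it has no 0, or no 1),
-- or has a 0 in some row a and a 1 in some row b ≠ a.  A simple matrix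
-- contains each one-sided column at most once, and avoiding (p′+1)·[0;1]
-- means at most p′ columns for each ordered pair (a, b): this is the upper
-- bound #one-sided + p′·m(m-1).  Conversely, take all one-sided columns and,
-- for each pair (a, b), p′ "special" columns with 0 in row a, 1 in row b and
-- entries outside {0,1} elsewhere; such a column has its unique 0 in row a
-- and its unique 1 in row b, so this matrix is simple and avoids (p′+1)·[0;1].
-- There are (r-2)^(m-2) special columns per pair, which is where the
-- hypothesis enters, and 2(r-1)^m - (r-2)^m one-sided columns by
-- inclusion–exclusion.
module Submission where

open import Data.Nat using (ℕ; zero; suc; _+_; _*_; _∸_; _^_; _⊓_; _≤_; z≤n; s≤s; s≤s⁻¹)
open import Data.Nat.Properties
open import Data.Bool using (Bool; true; false; _∧_; _∨_; not; if_then_else_)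
open import Data.Bool.Properties
  using (∧-identityʳ; ∧-zeroʳ; ∧-commutativeMonoid; ∧-conicalˡ; ∧-conicalʳ; ¬-not; not-injective)
open import Data.Fin using (Fin; zero; suc; toℕ)
import Data.Fin as Fin
open import Data.Fin.Properties using (injective⇒≤) renaming (suc-injective to fsuc-injective)
import Data.Vec.Functional as V
open import Data.List using (List; []; _∷_; _++_; length; map; take; lookup; filterᵇ)
open import Data.List.Properties using (length-take)
open import Data.Product using (Σ; _×_; _,_; proj₁; proj₂)
open import Data.Empty using (⊥; ⊥-elim)
open import Function using (_∘_)
open import Function.Definitions using (Injective)
open import Relation.Binary.PropositionalEquality
open import Relation.Nullary using (¬_; Dec; yes; no; does)
open import Relation.Nullary.Decidable using (dec-true; dec-false)
open import Algebra.Bundles using (CommutativeMonoid)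
open import Algebra.Properties.CommutativeSemigroup +-commutativeSemigroup
  using () renaming (interchange to +-interchange)
open import Algebra.Properties.CommutativeSemigroup (CommutativeMonoid.commutativeSemigroup ∧-commutativeMonoid)
  using () renaming (interchange to ∧-interchange)
open import Algebra.Properties.CommutativeMonoid.Sum +-0-commutativeMonoid
  using (sum-syntax; sum-cong-≗; ∑-distrib-+; ∑-comm)
open import Defs

⟦_⟧ : Bool → ℕ
⟦ true ⟧ = 1
⟦ false ⟧ = 0

true≢false : true ≢ false
true≢false ()

count : ∀ n → (Fin n → Bool) → ℕ
count n P = ∑[ i < n ] ⟦ P i ⟧

∑-mono : ∀ n {f g : Fin n → ℕ} → (∀ i → f i ≤ g i) → ∑[ i < n ] f i ≤ ∑[ i < n ] g i
∑-mono zero le = z≤n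
∑-mono (suc n) le = +-mono-≤ (le zero) (∑-mono n (λ i → le (suc i)))

∑-const : ∀ n c → ∑[ i < n ] c ≡ n * c
∑-const zero c = refl
∑-const (suc n) c = cong (c +_) (∑-const n c)

∑-zero : ∀ n {f : Fin n → ℕ} → (∀ i → f i ≡ 0) → ∑[ i < n ] f i ≡ 0
∑-zero n f≡0 = trans (sum-cong-≗ f≡0) (trans (∑-const n 0) (*-zeroʳ n))

∑-*ʳ : ∀ n (f : Fin n → ℕ) c → ∑[ i < n ] (f i * c) ≡ (∑[ i < n ] f i) * c
∑-*ʳ zero f c = refl
∑-*ʳ (suc n) f c = trans (cong (f zero * c +_) (∑-*ʳ n (f ∘ suc) c)) (sym (*-distribʳ-+ c (f zero) _))

∑-term : ∀ n (f : Fin n → ℕ) i → f i ≤ ∑[ i < n ] f i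
∑-term (suc n) f zero = m≤m+n (f zero) _
∑-term (suc n) f (suc i) = ≤-trans (∑-term n (f ∘ suc) i) (m≤n+m _ (f zero))

∑-single : ∀ n (f : Fin n → ℕ) i₀ → (∀ i → i ≢ i₀ → f i ≡ 0) → ∑[ i < n ] f i ≡ f i₀
∑-single (suc n) f zero others =
  trans (cong (f zero +_) (∑-zero n (λ i → others (suc i) λ ()))) (+-identityʳ (f zero))
∑-single (suc n) f (suc i₀) others =
  trans (cong (_+ ∑[ i < n ] f (suc i)) (others zero λ ()))
        (∑-single n (f ∘ suc) i₀ (λ i i≢i₀ → others (suc i) (i≢i₀ ∘ fsuc-injective)))

count-none : ∀ n {P : Fin n → Bool} → (∀ i → P i ≡ false) → count n P ≡ 0
count-none n none = ∑-zero n (cong ⟦_⟧ ∘ none)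

count-all : ∀ n → count n (λ _ → true) ≡ n
count-all n = trans (∑-const n 1) (*-identityʳ n)

⟦∨⟧+⟦∧⟧ : ∀ a b → ⟦ a ∨ b ⟧ + ⟦ a ∧ b ⟧ ≡ ⟦ a ⟧ + ⟦ b ⟧
⟦∨⟧+⟦∧⟧ true true = refl
⟦∨⟧+⟦∧⟧ true false = refl
⟦∨⟧+⟦∧⟧ false b = +-identityʳ ⟦ b ⟧

count-∨∧ : ∀ n (P Q : Fin n → Bool) →
  count n (λ i → P i ∨ Q i) + count n (λ i → P i ∧ Q i) ≡ count n P + count n Q
count-∨∧ n P Q = begin
  count n (λ i → P i ∨ Q i) + count n (λ i → P i ∧ Q i) ≡⟨ ∑-distrib-+ (λ i → ⟦ P i ∨ Q i ⟧) _ ⟨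
  ∑[ i < n ] (⟦ P i ∨ Q i ⟧ + ⟦ P i ∧ Q i ⟧)              ≡⟨ sum-cong-≗ (λ i → ⟦∨⟧+⟦∧⟧ (P i) (Q i)) ⟩
  ∑[ i < n ] (⟦ P i ⟧ + ⟦ Q i ⟧)                          ≡⟨ ∑-distrib-+ (λ i → ⟦ P i ⟧) _ ⟩
  count n P + count n Q                                  ∎
  where open ≡-Reasoning

count-not : ∀ n (P : Fin n → Bool) → count n P + count n (not ∘ P) ≡ n
count-not n P = begin
  count n P + count n (not ∘ P)          ≡⟨ ∑-distrib-+ (λ i → ⟦ P i ⟧) _ ⟨
  ∑[ i < n ] (⟦ P i ⟧ + ⟦ not (P i) ⟧)   ≡⟨ sum-cong-≗ (λ i → ⟦⟧+⟦not⟧ (P i)) ⟩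
  count n (λ _ → true)                   ≡⟨ count-all n ⟩
  n                                      ∎
  where
  open ≡-Reasoning
  ⟦⟧+⟦not⟧ : ∀ b → ⟦ b ⟧ + ⟦ not b ⟧ ≡ 1
  ⟦⟧+⟦not⟧ true = refl
  ⟦⟧+⟦not⟧ false = refl

count-complement : ∀ n (P : Fin n → Bool) c → count n P ≡ c → count n (not ∘ P) ≡ n ∸ c
count-complement n P c count≡c = begin
  count n (not ∘ P)                  ≡⟨ m+n∸m≡n c _ ⟨
  c + count n (not ∘ P) ∸ c          ≡⟨ cong (λ x → x + count n (not ∘ P) ∸ c) count≡c ⟨
  count n P + count n (not ∘ P) ∸ c  ≡⟨ cong (_∸ c) (count-not n P) ⟩
  n ∸ c                              ∎
  where open ≡-Reasoning

module _ where
  private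
    -- The index layout of Fin (count (suc n) P), which starts with the
    -- slot of index zero exactly when P zero holds.
    here : ∀ b {c} → b ≡ true → Fin (⟦ b ⟧ + c)
    here true _ = zero

    there : ∀ b {c} → Fin c → Fin (⟦ b ⟧ + c)
    there true x = suc x
    there false x = x

    there-injective : ∀ b {c} {x y : Fin c} → there b x ≡ there b y → x ≡ y
    there-injective true = fsuc-injective
    there-injective false eq = eq

    here≢there : ∀ b {c} (e : b ≡ true) (x : Fin c) → here b e ≢ there b x
    here≢there true _ _ ()

  rank : ∀ n (P : Fin n → Bool) j → P j ≡ true → Fin (count n P)
  rank (suc n) P zero e = here (P zero) e
  rank (suc n) P (suc j) e = there (P zero) (rank n (P ∘ suc) j e)

  rank-injective : ∀ n (P : Fin n → Bool) j j′ (e : P j ≡ true) (e′ : P j′ ≡ true) →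
    rank n P j e ≡ rank n P j′ e′ → j ≡ j′
  rank-injective (suc n) P zero zero e e′ eq = refl
  rank-injective (suc n) P zero (suc j′) e e′ eq = ⊥-elim (here≢there (P zero) e _ eq)
  rank-injective (suc n) P (suc j) zero e e′ eq = ⊥-elim (here≢there (P zero) e′ _ (sym eq))
  rank-injective (suc n) P (suc j) (suc j′) e e′ eq =
    cong suc (rank-injective n (P ∘ suc) j j′ e e′ (there-injective (P zero) eq))

injection⇒≤count : ∀ n (P : Fin n → Bool) k (γ : Fin k → Fin n) →
  Injective _≡_ _≡_ γ → (∀ t → P (γ t) ≡ true) → k ≤ count n P
injection⇒≤count n P k γ γ-inj sat =
  injective⇒≤ {f = λ t → rank n P (γ t) (sat t)}
    (λ {s} {t} eq → γ-inj (rank-injective n P (γ s) (γ t) (sat s) (sat t) eq))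

≤count⇒injection : ∀ n (P : Fin n → Bool) k → k ≤ count n P →
  Σ (Fin k → Fin n) λ γ → Injective _≡_ _≡_ γ × (∀ t → P (γ t) ≡ true)
≤count⇒injection n P zero _ = (λ ()) , (λ {s} → ⊥-elim (¬Fin0 s)) , (λ ())
  where
  ¬Fin0 : Fin 0 → ⊥
  ¬Fin0 ()
≤count⇒injection (suc n) P (suc k) le with P zero in P0
... | true =
  let γ , γ-inj , sat = ≤count⇒injection n (P ∘ suc) k (s≤s⁻¹ le) in
  cons γ , cons-injective γ γ-inj , cons-sat γ sat
  where
  cons : (Fin k → Fin n) → Fin (suc k) → Fin (suc n)
  cons γ zero = zero
  cons γ (suc t) = suc (γ t)
  cons-injective : ∀ γ → Injective _≡_ _≡_ γ → Injective _≡_ _≡_ (cons γ)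
  cons-injective γ γ-inj {zero} {zero} _ = refl
  cons-injective γ γ-inj {suc s} {suc t} eq = cong suc (γ-inj (fsuc-injective eq))
  cons-sat : ∀ γ → (∀ t → P (suc (γ t)) ≡ true) → ∀ t → P (cons γ t) ≡ true
  cons-sat γ sat zero = P0
  cons-sat γ sat (suc t) = sat t
... | false =
  let γ , γ-inj , sat = ≤count⇒injection n (P ∘ suc) (suc k) le in
  suc ∘ γ , γ-inj ∘ fsuc-injective , sat

count≤ : ∀ n (P : Fin n → Bool) k →
  (∀ (γ : Fin (suc k) → Fin n) → Injective _≡_ _≡_ γ → (∀ t → P (γ t) ≡ true) → ⊥) →
  count n P ≤ k
count≤ n P k noFamily with count n P ≤? k
... | yes le = le
... | no nle =
  let γ , γ-inj , sat = ≤count⇒injection n P (suc k) (≰⇒> nle) in ⊥-elim (noFamily γ γ-inj sat)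

unique⇒count≤1 : ∀ n (P : Fin n → Bool) → (∀ a b → P a ≡ true → P b ≡ true → a ≡ b) → count n P ≤ 1
unique⇒count≤1 n P unique = count≤ n P 1 λ γ γ-inj sat →
  0≢1 (γ-inj (unique (γ zero) (γ (suc zero)) (sat zero) (sat (suc zero))))
  where
  0≢1 : Fin.zero {1} ≢ suc zero
  0≢1 ()

pair : ∀ {n} → Fin n → Fin n → Fin 2 → Fin n
pair a b zero = a
pair a b (suc zero) = b

pair-injective : ∀ {n} {a b : Fin n} → a ≢ b → Injective _≡_ _≡_ (pair a b)
pair-injective a≢b {zero} {zero} _ = refl
pair-injective a≢b {zero} {suc zero} eq = ⊥-elim (a≢b eq)
pair-injective a≢b {suc zero} {zero} eq = ⊥-elim (a≢b (sym eq))
pair-injective a≢b {suc zero} {suc zero} _ = refl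

count≤1⇒unique : ∀ n (P : Fin n → Bool) → count n P ≤ 1 → ∀ a b → P a ≡ true → P b ≡ true → a ≡ b
count≤1⇒unique n P ≤1 a b Pa Pb with a Fin.≟ b
... | yes a≡b = a≡b
... | no a≢b = ⊥-elim (1+n≰n (≤-trans (injection⇒≤count n P 2 (pair a b) (pair-injective a≢b) sat) ≤1))
  where
  sat : ∀ t → P (pair a b t) ≡ true
  sat zero = Pa
  sat (suc zero) = Pb

∑count≤1 : ∀ m n (U : Fin m → Fin n → Bool) →
  (∀ a b c d → U a b ≡ true → U c d ≡ true → a ≡ c × b ≡ d) →
  ∑[ a < m ] count n (U a) ≤ 1
∑count≤1 m n U unique =
  ≤-trans (∑-mono m (λ a → count≤1⇒⟦nonempty⟧ a))
          (unique⇒count≤1 m nonempty λ a c na nc →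
             proj₁ (unique a (witness a na) c (witness c nc) (witness-sat a na) (witness-sat c nc)))
  where
  nonempty : Fin m → Bool
  nonempty a with count n (U a)
  ... | zero = false
  ... | suc _ = true
  count≤1⇒⟦nonempty⟧ : ∀ a → count n (U a) ≤ ⟦ nonempty a ⟧
  count≤1⇒⟦nonempty⟧ a with count n (U a) | unique⇒count≤1 n (U a) (λ b d Ub Ud → proj₂ (unique a b a d Ub Ud))
  ... | zero | _ = z≤n
  ... | suc _ | ≤1 = ≤1
  positive : ∀ a → nonempty a ≡ true → 1 ≤ count n (U a)
  positive a na with count n (U a)
  ... | suc _ = s≤s z≤n
  witness : ∀ a → nonempty a ≡ true → Fin n
  witness a na = proj₁ (≤count⇒injection n (U a) 1 (positive a na)) zero
  witness-sat : ∀ a (na : nonempty a ≡ true) → U a (witness a na) ≡ true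
  witness-sat a na = proj₂ (proj₂ (≤count⇒injection n (U a) 1 (positive a na))) zero

private
  variable
    A B : Set

sumL : List A → (A → ℕ) → ℕ
sumL [] f = 0
sumL (x ∷ xs) f = f x + sumL xs f

countL : (A → Bool) → List A → ℕ
countL P xs = sumL xs (⟦_⟧ ∘ P)

sumL-cong : ∀ xs {f g : A → ℕ} → (∀ x → f x ≡ g x) → sumL xs f ≡ sumL xs g
sumL-cong [] f≡g = refl
sumL-cong (x ∷ xs) f≡g = cong₂ _+_ (f≡g x) (sumL-cong xs f≡g)

sumL-mono : ∀ xs {f g : A → ℕ} → (∀ x → f x ≤ g x) → sumL xs f ≤ sumL xs g
sumL-mono [] f≤g = z≤n
sumL-mono (x ∷ xs) f≤g = +-mono-≤ (f≤g x) (sumL-mono xs f≤g)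

sumL-++ : ∀ xs ys (f : A → ℕ) → sumL (xs ++ ys) f ≡ sumL xs f + sumL ys f
sumL-++ [] ys f = refl
sumL-++ (x ∷ xs) ys f = trans (cong (f x +_) (sumL-++ xs ys f)) (sym (+-assoc (f x) _ _))

sumL-map : ∀ (g : B → A) xs (f : A → ℕ) → sumL (map g xs) f ≡ sumL xs (f ∘ g)
sumL-map g [] f = refl
sumL-map g (x ∷ xs) f = cong (f (g x) +_) (sumL-map g xs f)

∑-sumL-comm : ∀ n xs (f : Fin n → A → ℕ) → ∑[ j < n ] sumL xs (f j) ≡ sumL xs (λ x → ∑[ j < n ] f j x)
∑-sumL-comm n [] f = ∑-zero n (λ _ → refl)
∑-sumL-comm n (x ∷ xs) f =
  trans (∑-distrib-+ (λ j → f j x) _) (cong (∑[ j < n ] f j x +_) (∑-sumL-comm n xs f))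

concatF : ∀ n → (Fin n → List A) → List A
concatF zero g = []
concatF (suc n) g = g zero ++ concatF n (g ∘ suc)

sumL-concatF : ∀ n (g : Fin n → List A) f → sumL (concatF n g) f ≡ ∑[ i < n ] sumL (g i) f
sumL-concatF zero g f = refl
sumL-concatF (suc n) g f = trans (sumL-++ (g zero) _ f) (cong (sumL (g zero) f +_) (sumL-concatF n (g ∘ suc) f))

countL-true : ∀ (xs : List A) → countL (λ _ → true) xs ≡ length xs
countL-true [] = refl
countL-true (x ∷ xs) = cong suc (countL-true xs)

countL-none : ∀ xs {P : A → Bool} → (∀ x → P x ≡ false) → countL P xs ≡ 0
countL-none [] none = refl
countL-none (x ∷ xs) none rewrite none x = countL-none xs none

countL-cong : ∀ xs {P Q : A → Bool} → (∀ x → P x ≡ Q x) → countL P xs ≡ countL Q xs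
countL-cong xs P≡Q = sumL-cong xs (cong ⟦_⟧ ∘ P≡Q)

countL-mono : ∀ xs {P Q : A → Bool} → (∀ x → P x ≡ true → Q x ≡ true) → countL P xs ≤ countL Q xs
countL-mono xs {P} {Q} P⇒Q = sumL-mono xs (λ x → ⟦⟧-mono (P x) (Q x) (P⇒Q x))
  where
  ⟦⟧-mono : ∀ a b → (a ≡ true → b ≡ true) → ⟦ a ⟧ ≤ ⟦ b ⟧
  ⟦⟧-mono true b a⇒b rewrite a⇒b refl = ≤-refl
  ⟦⟧-mono false b _ = z≤n

countL-≤length : ∀ (xs : List A) P → countL P xs ≤ length xs
countL-≤length xs P = ≤-trans (countL-mono xs (λ _ _ → refl)) (≤-reflexive (countL-true xs))

countL-∨∧ : ∀ xs (P Q : A → Bool) →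
  countL (λ x → P x ∨ Q x) xs + countL (λ x → P x ∧ Q x) xs ≡ countL P xs + countL Q xs
countL-∨∧ [] P Q = refl
countL-∨∧ (x ∷ xs) P Q = begin
  (⟦ P x ∨ Q x ⟧ + c∨) + (⟦ P x ∧ Q x ⟧ + c∧) ≡⟨ +-interchange ⟦ P x ∨ Q x ⟧ c∨ ⟦ P x ∧ Q x ⟧ c∧ ⟩
  (⟦ P x ∨ Q x ⟧ + ⟦ P x ∧ Q x ⟧) + (c∨ + c∧) ≡⟨ cong₂ _+_ (⟦∨⟧+⟦∧⟧ (P x) (Q x)) (countL-∨∧ xs P Q) ⟩
  (⟦ P x ⟧ + ⟦ Q x ⟧) + (countL P xs + countL Q xs) ≡⟨ +-interchange ⟦ P x ⟧ ⟦ Q x ⟧ _ _ ⟩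
  (⟦ P x ⟧ + countL P xs) + (⟦ Q x ⟧ + countL Q xs) ∎
  where
  open ≡-Reasoning
  c∨ c∧ : ℕ
  c∨ = countL (λ y → P y ∨ Q y) xs
  c∧ = countL (λ y → P y ∧ Q y) xs

countL-filterᵇ : ∀ (S P : A → Bool) xs → countL P (filterᵇ S xs) ≡ countL (λ x → S x ∧ P x) xs
countL-filterᵇ S P [] = refl
countL-filterᵇ S P (x ∷ xs) with S x
... | true = cong (⟦ P x ⟧ +_) (countL-filterᵇ S P xs)
... | false = countL-filterᵇ S P xs

length-filterᵇ : ∀ (S : A → Bool) xs → length (filterᵇ S xs) ≡ countL S xs
length-filterᵇ S xs = begin
  length (filterᵇ S xs)                   ≡⟨ countL-true (filterᵇ S xs) ⟨
  countL (λ _ → true) (filterᵇ S xs)      ≡⟨ countL-filterᵇ S (λ _ → true) xs ⟩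
  countL (λ x → S x ∧ true) xs            ≡⟨ countL-cong xs (λ x → ∧-identityʳ (S x)) ⟩
  countL S xs                             ∎
  where open ≡-Reasoning

countL-take : ∀ k (xs : List A) P → countL P (take k xs) ≤ countL P xs
countL-take zero xs P = z≤n
countL-take (suc k) [] P = z≤n
countL-take (suc k) (x ∷ xs) P = +-monoʳ-≤ ⟦ P x ⟧ (countL-take k xs P)

count-lookup : ∀ (xs : List A) P → count (length xs) (λ j → P (lookup xs j)) ≡ countL P xs
count-lookup [] P = refl
count-lookup (x ∷ xs) P = cong (⟦ P x ⟧ +_) (count-lookup xs P)

Column : ℕ → ℕ → Set
Column m r = Fin m → Fin r

every : ∀ m → (Fin m → Bool) → Bool
every zero f = true
every (suc m) f = f zero ∧ every m (f ∘ suc)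

every-true : ∀ m f → every m f ≡ true → ∀ k → f k ≡ true
every-true (suc m) f e zero = ∧-conicalˡ (f zero) _ e
every-true (suc m) f e (suc k) = every-true m (f ∘ suc) (∧-conicalʳ (f zero) _ e) k

every-intro : ∀ m f → (∀ k → f k ≡ true) → every m f ≡ true
every-intro zero f all = refl
every-intro (suc m) f all = cong₂ _∧_ (all zero) (every-intro m (f ∘ suc) (all ∘ suc))

every-false : ∀ m f → every m f ≡ false → Σ (Fin m) λ k → f k ≡ false
every-false (suc m) f e with f zero in f0
... | false = zero , f0
... | true = let k , fk = every-false m (f ∘ suc) e in suc k , fk

every-cong : ∀ m {f g} → (∀ k → f k ≡ g k) → every m f ≡ every m g
every-cong zero f≡g = refl
every-cong (suc m) f≡g = cong₂ _∧_ (f≡g zero) (every-cong m (f≡g ∘ suc))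

every-∧ : ∀ m f g → every m f ∧ every m g ≡ every m (λ k → f k ∧ g k)
every-∧ zero f g = refl
every-∧ (suc m) f g =
  trans (∧-interchange (f zero) _ (g zero) _) (cong ((f zero ∧ g zero) ∧_) (every-∧ m (f ∘ suc) (g ∘ suc)))

product : ∀ n → (Fin n → ℕ) → ℕ
product zero f = 1
product (suc n) f = f zero * product n (f ∘ suc)

product-cong : ∀ n {f g : Fin n → ℕ} → (∀ k → f k ≡ g k) → product n f ≡ product n g
product-cong zero f≡g = refl
product-cong (suc n) f≡g = cong₂ _*_ (f≡g zero) (product-cong n (f≡g ∘ suc))

product-const : ∀ n c → product n (λ _ → c) ≡ c ^ n
product-const zero c = refl
product-const (suc n) c = cong (c *_) (product-const n c)

product-if : ∀ n (B : Fin n → Bool) c → product n (λ k → if B k then 1 else c) ≡ c ^ count n (not ∘ B)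
product-if zero B c = refl
product-if (suc n) B c with B zero
... | true = trans (+-identityʳ _) (product-if n (B ∘ suc) c)
... | false = cong (c *_) (product-if n (B ∘ suc) c)

columns : ∀ m r → List (Column m r)
columns zero r = (λ ()) ∷ []
columns (suc m) r = concatF r (λ x → map (x V.∷_) (columns m r))

countL-columns : ∀ m r (Q : Fin m → Fin r → Bool) →
  countL (λ v → every m (λ k → Q k (v k))) (columns m r) ≡ product m (λ k → count r (Q k))
countL-columns zero r Q = refl
countL-columns (suc m) r Q = begin
  countL P (concatF r (λ x → map (x V.∷_) (columns m r)))   ≡⟨ sumL-concatF r _ _ ⟩
  ∑[ x < r ] countL P (map (x V.∷_) (columns m r))         ≡⟨ sum-cong-≗ (λ x → sumL-map (x V.∷_) (columns m r) _) ⟩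
  ∑[ x < r ] countL (λ v → Q zero x ∧ R v) (columns m r)   ≡⟨ sum-cong-≗ (λ x → countL-∧ (Q zero x)) ⟩
  ∑[ x < r ] (⟦ Q zero x ⟧ * countL R (columns m r))       ≡⟨ ∑-*ʳ r _ _ ⟩
  count r (Q zero) * countL R (columns m r)                ≡⟨ cong (count r (Q zero) *_) (countL-columns m r (Q ∘ suc)) ⟩
  product (suc m) (λ k → count r (Q k))                    ∎
  where
  open ≡-Reasoning
  P : Column (suc m) r → Bool
  P v = every (suc m) (λ k → Q k (v k))
  R : Column m r → Bool
  R v = every m (λ k → Q (suc k) (v k))
  countL-∧ : ∀ b → countL (λ v → b ∧ R v) (columns m r) ≡ ⟦ b ⟧ * countL R (columns m r)
  countL-∧ true = sym (+-identityʳ _)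
  countL-∧ false = countL-none (columns m r) (λ _ → refl)

_=ᶠ_ : ∀ {r} → Fin r → Fin r → Bool
a =ᶠ b = does (a Fin.≟ b)

=ᶠ-sound : ∀ {r} (a b : Fin r) → a =ᶠ b ≡ true → a ≡ b
=ᶠ-sound a b e with a Fin.≟ b
... | yes a≡b = a≡b

=ᶠ-refl : ∀ {r} (a : Fin r) → a =ᶠ a ≡ true
=ᶠ-refl a = dec-true (a Fin.≟ a) refl

count-=ᶠ : ∀ r (c : Fin r) → count r (_=ᶠ c) ≡ 1
count-=ᶠ r c = trans (∑-single r _ c (λ x x≢c → cong ⟦_⟧ (dec-false (x Fin.≟ c) x≢c)))
                     (cong ⟦_⟧ (=ᶠ-refl c))

_≐_ : ∀ {m r} → Column m r → Column m r → Bool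
_≐_ {m} v w = every m (λ k → v k =ᶠ w k)

≐-sound : ∀ {m r} (v w : Column m r) → v ≐ w ≡ true → ∀ k → v k ≡ w k
≐-sound {m} v w e k = =ᶠ-sound (v k) (w k) (every-true m _ e k)

≐-intro : ∀ {m r} (v w : Column m r) → (∀ k → v k ≡ w k) → v ≐ w ≡ true
≐-intro {m} v w v≡w = every-intro m _ (λ k → subst (λ x → v k =ᶠ x ≡ true) (v≡w k) (=ᶠ-refl (v k)))

countL-≐ : ∀ m r (w : Column m r) → countL (_≐ w) (columns m r) ≡ 1
countL-≐ m r w = begin
  countL (_≐ w) (columns m r)             ≡⟨ countL-columns m r (λ k → _=ᶠ w k) ⟩
  product m (λ k → count r (_=ᶠ w k))     ≡⟨ product-cong m (λ k → count-=ᶠ r (w k)) ⟩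
  product m (λ _ → 1)                     ≡⟨ product-const m 1 ⟩
  1 ^ m                                   ≡⟨ ^-zeroˡ m ⟩
  1                                       ∎
  where open ≡-Reasoning

Extensional : ∀ {m r} → (Column m r → Bool) → Set
Extensional P = ∀ v w → (∀ k → v k ≡ w k) → P v ≡ P w

countL-singleton : ∀ m r (P : Column m r → Bool) → Extensional P → ∀ w →
  countL (λ v → P v ∧ v ≐ w) (columns m r) ≡ ⟦ P w ⟧
countL-singleton m r P ext w = begin
  countL (λ v → P v ∧ v ≐ w) (columns m r)   ≡⟨ countL-cong (columns m r) move ⟩
  countL (λ v → P w ∧ v ≐ w) (columns m r)   ≡⟨ pull (P w) ⟩
  ⟦ P w ⟧                                    ∎
  where
  open ≡-Reasoning
  move : ∀ v → P v ∧ v ≐ w ≡ P w ∧ v ≐ w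
  move v with v ≐ w in e
  ... | true = cong (_∧ true) (ext v w (≐-sound v w e))
  ... | false = trans (∧-zeroʳ (P v)) (sym (∧-zeroʳ (P w)))
  pull : ∀ b → countL (λ v → b ∧ v ≐ w) (columns m r) ≡ ⟦ b ⟧
  pull true = countL-≐ m r w
  pull false = countL-none (columns m r) (λ _ → refl)

isZero : ∀ {r} → Fin r → Bool
isZero zero = true
isZero (suc _) = false

isOne : ∀ {r} → Fin r → Bool
isOne zero = false
isOne (suc zero) = true
isOne (suc (suc _)) = false

isZero-toℕ : ∀ {r} (x : Fin r) → isZero x ≡ true → toℕ x ≡ 0
isZero-toℕ zero _ = refl

toℕ-isZero : ∀ {r} (x : Fin r) → toℕ x ≡ 0 → isZero x ≡ true
toℕ-isZero zero _ = refl

isOne-toℕ : ∀ {r} (x : Fin r) → isOne x ≡ true → toℕ x ≡ 1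
isOne-toℕ (suc zero) _ = refl

toℕ-isOne : ∀ {r} (x : Fin r) → toℕ x ≡ 1 → isOne x ≡ true
toℕ-isOne (suc zero) _ = refl

zero≢one : ∀ {r} (x : Fin r) → isZero x ≡ true → isOne x ≡ true → ⊥
zero≢one zero _ ()

zeroFree oneFree oneSided : ∀ {m r} → Column m r → Bool
zeroFree {m} w = every m (λ k → not (isZero (w k)))
oneFree {m} w = every m (λ k → not (isOne (w k)))
oneSided w = zeroFree w ∨ oneFree w

zeroOneAt : ∀ {m r} → Fin m → Fin m → Column m r → Bool
zeroOneAt a b w = isZero (w a) ∧ isOne (w b)

oneSided-extensional : ∀ {m r} → Extensional (oneSided {m} {r})
oneSided-extensional {m} v w v≡w =
  cong₂ _∨_ (every-cong m (λ k → cong (not ∘ isZero) (v≡w k)))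
            (every-cong m (λ k → cong (not ∘ isOne) (v≡w k)))

zeroOneAt-diagonal : ∀ {m r} a (w : Column m r) → zeroOneAt a a w ≡ false
zeroOneAt-diagonal a w = ¬-not (λ both → zero≢one (w a) (∧-conicalˡ _ _ both) (∧-conicalʳ _ _ both))

zeroOneAt⇒not-oneSided : ∀ {m r} a b (w : Column m r) → zeroOneAt a b w ≡ true → oneSided w ≡ false
zeroOneAt⇒not-oneSided {m} a b w zo =
  cong₂ _∨_ (entry-excluded (λ k → not (isZero (w k))) a (cong not (∧-conicalˡ _ _ zo)))
            (entry-excluded (λ k → not (isOne (w k))) b (cong not (∧-conicalʳ _ _ zo)))
  where
  entry-excluded : ∀ f k → f k ≡ false → every m f ≡ false
  entry-excluded f k fk = ¬-not λ all → true≢false (trans (sym (every-true m f all k)) fk)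

covering : ∀ {m r} (w : Column m r) → 1 ≤ ⟦ oneSided w ⟧ + ∑[ a < m ] ∑[ b < m ] ⟦ zeroOneAt a b w ⟧
covering {m} w with zeroFree w in zf | oneFree w in of
... | true | _ = s≤s z≤n
... | false | true = s≤s z≤n
... | false | false =
  let a , za = every-false m _ zf
      b , ob = every-false m _ of
  in begin
    1                                          ≡⟨ cong ⟦_⟧ (cong₂ _∧_ (not-injective za) (not-injective ob)) ⟨
    ⟦ zeroOneAt a b w ⟧                         ≤⟨ ∑-term m _ b ⟩
    ∑[ b′ < m ] ⟦ zeroOneAt a b′ w ⟧              ≤⟨ ∑-term m _ a ⟩
    ∑[ a′ < m ] ∑[ b′ < m ] ⟦ zeroOneAt a′ b′ w ⟧ ∎
  where open ≤-Reasoning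

module _ {m r n : ℕ} (A : RMatrix m r n) where
  column : Fin n → Column m r
  column j i = A i j

  simple⇒count≤1 : Simple A → ∀ v → count n (λ j → v ≐ column j) ≤ 1
  simple⇒count≤1 simple v = unique⇒count≤1 n _ λ j j′ vj vj′ →
    simple j j′ (λ i → trans (sym (≐-sound v (column j) vj i)) (≐-sound v (column j′) vj′ i))

  count≤1⇒simple : (∀ v → count n (λ j → column j ≐ v) ≤ 1) → Simple A
  count≤1⇒simple once j j′ same =
    count≤1⇒unique n _ (once (column j)) j j′
      (≐-intro (column j) (column j) (λ _ → refl)) (≐-intro (column j′) (column j) (sym ∘ same))

  zeroOneCount : Fin m → Fin m → ℕ
  zeroOneCount a b = count n (λ j → zeroOneAt a b (column j))

  -- A copy of (p′+1)·[0;1] is p′+1 columns with 0 in one row and 1 in another,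
  -- so avoiding it bounds every zeroOneCount by p′, and conversely.
  avoids⇒zeroOneCount≤ : ∀ p′ → Avoids (pCopies01 (suc p′)) A → ∀ a b → zeroOneCount a b ≤ p′
  avoids⇒zeroOneCount≤ p′ avoid a b = count≤ n _ p′ λ γ γ-inj zo →
    avoid (pair a b , γ , pair-injective (a≢b (zo zero)) , γ-inj , match γ zo)
    where
    a≢b : ∀ {j} → zeroOneAt a b (column j) ≡ true → a ≢ b
    a≢b {j} zo refl = true≢false (trans (sym zo) (zeroOneAt-diagonal a (column j)))
    match : ∀ γ → (∀ t → zeroOneAt a b (column (γ t)) ≡ true) →
            ∀ i t → toℕ (A (pair a b i) (γ t)) ≡ pCopies01 (suc p′) i t
    match γ zo zero t = isZero-toℕ _ (∧-conicalˡ _ _ (zo t))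
    match γ zo (suc zero) t = isOne-toℕ _ (∧-conicalʳ _ _ (zo t))

  zeroOneCount≤⇒avoids : ∀ p′ → (∀ a b → zeroOneCount a b ≤ p′) → Avoids (pCopies01 (suc p′)) A
  zeroOneCount≤⇒avoids p′ few (ρ , γ , _ , γ-inj , match) =
    1+n≰n (≤-trans (injection⇒≤count n _ (suc p′) γ γ-inj zo) (few (ρ zero) (ρ (suc zero))))
    where
    zo : ∀ t → zeroOneAt (ρ zero) (ρ (suc zero)) (column (γ t)) ≡ true
    zo t = cong₂ _∧_ (toℕ-isZero _ (match zero t)) (toℕ-isOne _ (match (suc zero) t))

budget : ∀ {m} → ℕ → Fin m → Fin m → ℕ
budget p′ a b = ⟦ not (b =ᶠ a) ⟧ * p′

budget-total : ∀ m p′ → ∑[ a < m ] ∑[ b < m ] budget p′ a b ≡ p′ * m * (m ∸ 1)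
budget-total m p′ = begin
  ∑[ a < m ] ∑[ b < m ] budget p′ a b         ≡⟨ sum-cong-≗ (λ a → ∑-*ʳ m (λ b → ⟦ not (b =ᶠ a) ⟧) p′) ⟩
  ∑[ a < m ] (count m (not ∘ (_=ᶠ a)) * p′)   ≡⟨ sum-cong-≗ (λ a → cong (_* p′) (count-complement m _ 1 (count-=ᶠ m a))) ⟩
  ∑[ a < m ] ((m ∸ 1) * p′)                   ≡⟨ ∑-const m _ ⟩
  m * ((m ∸ 1) * p′)                          ≡⟨ *-assoc m (m ∸ 1) p′ ⟨
  m * (m ∸ 1) * p′                            ≡⟨ *-comm (m * (m ∸ 1)) p′ ⟩
  p′ * (m * (m ∸ 1))                          ≡⟨ *-assoc p′ m (m ∸ 1) ⟨
  p′ * m * (m ∸ 1)                            ∎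
  where open ≡-Reasoning

distinctColumns≤ : ∀ {m r n} (A : RMatrix m r n) → Simple A →
  (P : Column m r → Bool) → Extensional P → count n (λ j → P (column A j)) ≤ countL P (columns m r)
distinctColumns≤ {m} {r} {n} A simple P ext = begin
  count n (λ j → P (column A j))                                ≡⟨ sum-cong-≗ (λ j → countL-singleton m r P ext (column A j)) ⟨
  ∑[ j < n ] countL (λ v → P v ∧ v ≐ column A j) (columns m r)  ≡⟨ ∑-sumL-comm n (columns m r) _ ⟩
  sumL (columns m r) (λ v → count n (λ j → P v ∧ v ≐ column A j)) ≤⟨ sumL-mono (columns m r) occurrences ⟩
  countL P (columns m r)                                        ∎
  where
  open ≤-Reasoning
  occurrences : ∀ v → count n (λ j → P v ∧ v ≐ column A j) ≤ ⟦ P v ⟧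
  occurrences v with P v
  ... | true = simple⇒count≤1 A simple v
  ... | false = ≤-reflexive (count-none n (λ _ → refl))

zeroOneCount≤budget : ∀ {m r n} p′ (A : RMatrix m r n) → Avoids (pCopies01 (suc p′)) A →
  ∀ a b → zeroOneCount A a b ≤ budget p′ a b
zeroOneCount≤budget {n = n} p′ A avoid a b with b Fin.≟ a
... | yes refl = ≤-reflexive (count-none n (λ j → zeroOneAt-diagonal a (column A j)))
... | no _ = ≤-trans (avoids⇒zeroOneCount≤ A p′ avoid a b) (≤-reflexive (sym (+-identityʳ p′)))

-- Upper bound: cover each column by its kind, then count each kind.
upperBound : ∀ {m r} p′ {n} (A : RMatrix m r n) → Simple A → Avoids (pCopies01 (suc p′)) A →
  n ≤ countL oneSided (columns m r) + p′ * m * (m ∸ 1)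
upperBound {m} {r} p′ {n} A simple avoid = begin
  n                                                                 ≡⟨ count-all n ⟨
  ∑[ j < n ] 1                                                      ≤⟨ ∑-mono n (λ j → covering (column A j)) ⟩
  ∑[ j < n ] (⟦ oneSided (column A j) ⟧ + zeroOnes j)                ≡⟨ ∑-distrib-+ (λ j → ⟦ oneSided (column A j) ⟧) zeroOnes ⟩
  count n (oneSided ∘ column A) + ∑[ j < n ] zeroOnes j             ≡⟨ cong (count n (oneSided ∘ column A) +_) regroup ⟩
  count n (oneSided ∘ column A) + ∑[ a < m ] ∑[ b < m ] zeroOneCount A a b
    ≤⟨ +-mono-≤ (distinctColumns≤ A simple oneSided oneSided-extensional)
                (∑-mono m (λ a → ∑-mono m (zeroOneCount≤budget p′ A avoid a))) ⟩
  countL oneSided (columns m r) + ∑[ a < m ] ∑[ b < m ] budget p′ a b ≡⟨ cong (countL oneSided (columns m r) +_) (budget-total m p′) ⟩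
  countL oneSided (columns m r) + p′ * m * (m ∸ 1)                  ∎
  where
  open ≤-Reasoning
  zeroOnes : Fin n → ℕ
  zeroOnes j = ∑[ a < m ] ∑[ b < m ] ⟦ zeroOneAt a b (column A j) ⟧
  regroup : ∑[ j < n ] zeroOnes j ≡ ∑[ a < m ] ∑[ b < m ] zeroOneCount A a b
  regroup = trans (∑-comm (λ j a → ∑[ b < m ] ⟦ zeroOneAt a b (column A j) ⟧))
                  (sum-cong-≗ (λ a → ∑-comm (λ j b → ⟦ zeroOneAt a b (column A j) ⟧)))

-- Special columns for an ordered pair (a, b) of distinct rows: a 0 in row a,
-- a 1 in row b, and entries other than 0 and 1 in every other row.  For
-- a = b the condition in row a is unsatisfiable, so there are none.
other : ∀ {r} → Fin r → Bool
other x = not (isZero x) ∧ not (isOne x)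

specialEntry : ∀ {m r} → Fin m → Fin m → Fin m → Fin r → Bool
specialEntry a b k x = if k =ᶠ a then not (k =ᶠ b) ∧ isZero x else if k =ᶠ b then isOne x else other x

special : ∀ {m r} → Fin m → Fin m → Column m r → Bool
special {m} a b w = every m (λ k → specialEntry a b k (w k))

special-extensional : ∀ {m r} (a b : Fin m) → Extensional (special {m} {r} a b)
special-extensional {m} a b v w v≡w = every-cong m (λ k → cong (specialEntry a b k) (v≡w k))

special⇒zeroOneAt : ∀ {m r} a b (w : Column m r) → special a b w ≡ true → zeroOneAt a b w ≡ true
special⇒zeroOneAt {m} a b w sp = cong₂ _∧_ (row-a (w a) (every-true m _ sp a)) (row-b (w b) (every-true m _ sp b))
  where
  row-a : ∀ x → specialEntry a b a x ≡ true → isZero x ≡ true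
  row-a x e rewrite =ᶠ-refl a = ∧-conicalʳ _ _ e
  row-b : ∀ x → specialEntry a b b x ≡ true → isOne x ≡ true
  row-b x e with b =ᶠ a
  ... | true rewrite =ᶠ-refl b = ⊥-elim (true≢false (sym e))
  ... | false rewrite =ᶠ-refl b = e

special-zeroOneAt : ∀ {m r} a b c d (w : Column m r) → special a b w ≡ true → zeroOneAt c d w ≡ true →
  c ≡ a × d ≡ b
special-zeroOneAt {m} a b c d w sp zo =
  zero-row c (w c) (every-true m _ sp c) (∧-conicalˡ _ _ zo) ,
  one-row d (w d) (every-true m _ sp d) (∧-conicalʳ _ _ zo)
  where
  zero-row : ∀ k x → specialEntry a b k x ≡ true → isZero x ≡ true → k ≡ a
  zero-row k x e z with k =ᶠ a in ka | k =ᶠ b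
  ... | true | _ = =ᶠ-sound k a ka
  ... | false | true = ⊥-elim (zero≢one x z e)
  ... | false | false = ⊥-elim (true≢false (trans (sym z) (not-injective (∧-conicalˡ _ _ e))))
  one-row : ∀ k x → specialEntry a b k x ≡ true → isOne x ≡ true → k ≡ b
  one-row k x e o with k =ᶠ a | k =ᶠ b in kb
  ... | true | _ = ⊥-elim (zero≢one x (∧-conicalʳ _ _ e) o)
  ... | false | true = =ᶠ-sound k b kb
  ... | false | false = ⊥-elim (true≢false (trans (sym o) (not-injective (∧-conicalʳ _ _ e))))

oneSided+special≤1 : ∀ {m r} (v : Column m r) → ⟦ oneSided v ⟧ + ∑[ a < m ] count m (λ b → special a b v) ≤ 1
oneSided+special≤1 {m} v with oneSided v in os
... | true = ≤-reflexive (cong suc (∑-zero m (λ a → count-none m (λ b → ¬-not (λ sp →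
               true≢false (trans (sym os) (zeroOneAt⇒not-oneSided a b v (special⇒zeroOneAt a b v sp))))))))
... | false = ∑count≤1 m m (λ a b → special a b v) λ a b c d spab spcd →
               special-zeroOneAt c d a b v spcd (special⇒zeroOneAt a b v spab)

fromColumns : ∀ {m r} (cs : List (Column m r)) → RMatrix m r (length cs)
fromColumns cs i j = lookup cs j i

fromColumns-simple : ∀ {m r} (cs : List (Column m r)) → (∀ v → countL (_≐ v) cs ≤ 1) → Simple (fromColumns cs)
fromColumns-simple cs once = count≤1⇒simple (fromColumns cs) λ v →
  ≤-trans (≤-reflexive (count-lookup cs (_≐ v))) (once v)

fromColumns-avoids : ∀ {m r} p′ (cs : List (Column m r)) → (∀ a b → countL (zeroOneAt a b) cs ≤ p′) →
  Avoids (pCopies01 (suc p′)) (fromColumns cs)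
fromColumns-avoids p′ cs few = zeroOneCount≤⇒avoids (fromColumns cs) p′ λ a b →
  ≤-trans (≤-reflexive (count-lookup cs (zeroOneAt a b))) (few a b)

module Construction (m r p′ : ℕ) where
  specials : Fin m → Fin m → List (Column m r)
  specials a b = take p′ (filterᵇ (special a b) (columns m r))

  construction : List (Column m r)
  construction = filterᵇ oneSided (columns m r) ++ concatF m (λ a → concatF m (specials a))

  countL-construction : ∀ P → countL P construction ≡
    countL (λ w → oneSided w ∧ P w) (columns m r) + ∑[ a < m ] ∑[ b < m ] countL P (specials a b)
  countL-construction P =
    trans (sumL-++ (filterᵇ oneSided (columns m r)) _ _)
          (cong₂ _+_ (countL-filterᵇ oneSided P (columns m r))
                     (trans (sumL-concatF m _ _) (sum-cong-≗ (λ a → sumL-concatF m (specials a) _))))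

  countL-specials : ∀ P a b → countL P (specials a b) ≤ countL (λ w → special a b w ∧ P w) (columns m r)
  countL-specials P a b =
    ≤-trans (countL-take p′ _ P) (≤-reflexive (countL-filterᵇ (special a b) P (columns m r)))

  length-specials : (∀ a b → a ≢ b → p′ ≤ countL (special a b) (columns m r)) →
    ∀ a b → length (specials a b) ≡ budget p′ a b
  length-specials enough a b = trans (length-take p′ _) (trans (cong (p′ ⊓_) (length-filterᵇ (special a b) (columns m r))) (cut (b Fin.≟ a)))
    where
    cut : (d : Dec (b ≡ a)) → p′ ⊓ countL (special a b) (columns m r) ≡ ⟦ not (does d) ⟧ * p′
    cut (yes refl) = trans (cong (p′ ⊓_) (countL-none (columns m r) λ w → ¬-not λ sp →
                       true≢false (trans (sym (special⇒zeroOneAt b b w sp)) (zeroOneAt-diagonal b w))))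
                       (⊓-zeroʳ p′)
    cut (no b≢a) = trans (m≤n⇒m⊓n≡m (enough a b (b≢a ∘ sym))) (sym (+-identityʳ p′))

  length-construction : (∀ a b → a ≢ b → p′ ≤ countL (special a b) (columns m r)) →
    length construction ≡ countL oneSided (columns m r) + p′ * m * (m ∸ 1)
  length-construction enough = begin
    length construction                                                          ≡⟨ countL-true construction ⟨
    countL (λ _ → true) construction                                             ≡⟨ countL-construction (λ _ → true) ⟩
    countL (λ w → oneSided w ∧ true) (columns m r) + ∑[ a < m ] ∑[ b < m ] countL (λ _ → true) (specials a b)
      ≡⟨ cong₂ _+_ (countL-cong (columns m r) (λ w → ∧-identityʳ (oneSided w)))
                   (sum-cong-≗ λ a → sum-cong-≗ λ b → trans (countL-true (specials a b)) (length-specials enough a b)) ⟩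
    countL oneSided (columns m r) + ∑[ a < m ] ∑[ b < m ] budget p′ a b          ≡⟨ cong (countL oneSided (columns m r) +_) (budget-total m p′) ⟩
    countL oneSided (columns m r) + p′ * m * (m ∸ 1)                             ∎
    where open ≡-Reasoning

  -- No column occurs twice: the classes of oneSided+special≤1 are disjoint.
  construction-once : ∀ v → countL (_≐ v) construction ≤ 1
  construction-once v = begin
    countL (_≐ v) construction                                            ≡⟨ countL-construction (_≐ v) ⟩
    countL (λ w → oneSided w ∧ w ≐ v) (columns m r) + ∑[ a < m ] ∑[ b < m ] countL (_≐ v) (specials a b)
      ≤⟨ +-mono-≤ (≤-reflexive (countL-singleton m r oneSided oneSided-extensional v))
                  (∑-mono m λ a → ∑-mono m λ b → ≤-trans (countL-specials (_≐ v) a b)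
                    (≤-reflexive (countL-singleton m r (special a b) (special-extensional a b) v))) ⟩
    ⟦ oneSided v ⟧ + ∑[ a < m ] count m (λ b → special a b v)               ≤⟨ oneSided+special≤1 v ⟩
    1                                                                     ∎
    where open ≤-Reasoning

  -- Only the p′ special columns of (a, b) have a 0 in row a and a 1 in row b.
  construction-zeroOne : ∀ a b → countL (zeroOneAt a b) construction ≤ p′
  construction-zeroOne c d = begin
    countL (zeroOneAt c d) construction                                            ≡⟨ countL-construction (zeroOneAt c d) ⟩
    countL (λ w → oneSided w ∧ zeroOneAt c d w) (columns m r) + ∑[ a < m ] ∑[ b < m ] countL (zeroOneAt c d) (specials a b)
      ≡⟨ cong₂ _+_ (countL-none (columns m r) noOneSided)
                   (trans (∑-single m _ c (λ a a≢c → ∑-zero m (λ b → elsewhere a b (a≢c ∘ proj₁))))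
                          (∑-single m _ d (λ b b≢d → elsewhere c b (b≢d ∘ proj₂)))) ⟩
    countL (zeroOneAt c d) (specials c d)                                         ≤⟨ countL-≤length (specials c d) _ ⟩
    length (specials c d)                                                         ≡⟨ length-take p′ _ ⟩
    p′ ⊓ length (filterᵇ (special c d) (columns m r))                             ≤⟨ m⊓n≤m p′ _ ⟩
    p′                                                                            ∎
    where
    open ≤-Reasoning
    noOneSided : ∀ w → oneSided w ∧ zeroOneAt c d w ≡ false
    noOneSided w with zeroOneAt c d w in zo
    ... | true = cong (_∧ true) (zeroOneAt⇒not-oneSided c d w zo)
    ... | false = ∧-zeroʳ (oneSided w)
    elsewhere : ∀ a b → ¬ (a ≡ c × b ≡ d) → countL (zeroOneAt c d) (specials a b) ≡ 0
    elsewhere a b ne = n≤0⇒n≡0 (≤-trans (countL-specials (zeroOneAt c d) a b)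
      (≤-reflexive (countL-none (columns m r) λ w → ¬-not λ both →
        ne (let c≡a , d≡b = special-zeroOneAt a b c d w (∧-conicalˡ (special a b w) _ both) (∧-conicalʳ (special a b w) _ both) in sym c≡a , sym d≡b))))

lowerBound : ∀ m r p′ → (∀ a b → a ≢ b → p′ ≤ countL (special a b) (columns m r)) →
  Σ (RMatrix m r (countL oneSided (columns m r) + p′ * m * (m ∸ 1))) λ A →
    Simple A × Avoids (pCopies01 (suc p′)) A
lowerBound m r p′ enough =
  subst (λ N → Σ (RMatrix m r N) λ A → Simple A × Avoids (pCopies01 (suc p′)) A) (length-construction enough)
    (fromColumns construction , fromColumns-simple construction construction-once ,
     fromColumns-avoids p′ construction construction-zeroOne)
  where open Construction m r p′

module _ (k : ℕ) where
  count-notZero : count (2 + k) (not ∘ isZero) ≡ suc k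
  count-notZero = cong suc (count-all k)

  count-notOne : count (2 + k) (not ∘ isOne) ≡ suc k
  count-notOne = cong suc (count-all k)

  count-other : count (2 + k) other ≡ k
  count-other = count-all k

  count-isZero : count (2 + k) isZero ≡ 1
  count-isZero = cong suc (count-none k (λ _ → refl))

  count-isOne : count (2 + k) isOne ≡ 1
  count-isOne = cong suc (count-none k (λ _ → refl))

  countL-uniform : ∀ m (Q : Fin (2 + k) → Bool) c → count (2 + k) Q ≡ c →
    countL (λ v → every m (λ i → Q (v i))) (columns m (2 + k)) ≡ c ^ m
  countL-uniform m Q c count≡c =
    trans (countL-columns m (2 + k) (λ _ → Q)) (trans (product-cong m (λ _ → count≡c)) (product-const m c))

  -- Inclusion–exclusion: (k+1)^m zero-free, (k+1)^m one-free, k^m both.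
  countL-oneSided : ∀ m → countL oneSided (columns m (2 + k)) ≡ 2 * suc k ^ m ∸ k ^ m
  countL-oneSided m = begin
    countL oneSided cs                                                   ≡⟨ m+n∸n≡m _ (k ^ m) ⟨
    countL oneSided cs + k ^ m ∸ k ^ m                                   ≡⟨ cong (λ x → countL oneSided cs + x ∸ k ^ m) both ⟨
    countL oneSided cs + countL (λ w → zeroFree w ∧ oneFree w) cs ∸ k ^ m ≡⟨ cong (_∸ k ^ m) (countL-∨∧ cs zeroFree oneFree) ⟩
    countL zeroFree cs + countL oneFree cs ∸ k ^ m                        ≡⟨ cong₂ (λ x y → x + y ∸ k ^ m) zeroFrees oneFrees ⟩
    suc k ^ m + suc k ^ m ∸ k ^ m                                        ≡⟨ cong (λ x → suc k ^ m + x ∸ k ^ m) (+-identityʳ _) ⟨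
    2 * suc k ^ m ∸ k ^ m                                                ∎
    where
    open ≡-Reasoning
    cs = columns m (2 + k)
    zeroFrees : countL zeroFree cs ≡ suc k ^ m
    zeroFrees = countL-uniform m (not ∘ isZero) (suc k) count-notZero
    oneFrees : countL oneFree cs ≡ suc k ^ m
    oneFrees = countL-uniform m (not ∘ isOne) (suc k) count-notOne
    both : countL (λ w → zeroFree w ∧ oneFree w) cs ≡ k ^ m
    both = trans (countL-cong cs (λ w → every-∧ m _ _)) (countL-uniform m other k count-other)

  -- Rows a and b have one admissible entry each, the other m - 2 rows k each.
  countL-special : ∀ m (a b : Fin m) → a ≢ b → countL (special a b) (columns m (2 + k)) ≡ k ^ (m ∸ 2)
  countL-special m a b a≢b = begin
    countL (special a b) (columns m (2 + k))                  ≡⟨ countL-columns m (2 + k) (specialEntry a b) ⟩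
    product m (λ i → count (2 + k) (specialEntry a b i))      ≡⟨ product-cong m entries ⟩
    product m (λ i → if pinned i then 1 else k)               ≡⟨ product-if m pinned k ⟩
    k ^ count m (not ∘ pinned)                                ≡⟨ cong (k ^_) (count-complement m pinned 2 pinned-count) ⟩
    k ^ (m ∸ 2)                                               ∎
    where
    open ≡-Reasoning
    pinned : Fin m → Bool
    pinned i = i =ᶠ a ∨ i =ᶠ b
    entries : ∀ i → count (2 + k) (λ x → if i =ᶠ a then not (i =ᶠ b) ∧ isZero x else if i =ᶠ b then isOne x else other x)
                    ≡ (if pinned i then 1 else k)
    entries i with i =ᶠ a in ia | i =ᶠ b in ib
    ... | true | true = ⊥-elim (a≢b (trans (sym (=ᶠ-sound i a ia)) (=ᶠ-sound i b ib)))
    ... | true | false = count-isZero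
    ... | false | true = count-isOne
    ... | false | false = count-other
    pinned-count : count m pinned ≡ 2
    pinned-count = begin
      count m pinned                                        ≡⟨ +-identityʳ _ ⟨
      count m pinned + 0                                    ≡⟨ cong (count m pinned +_) (count-none m a-and-b) ⟨
      count m pinned + count m (λ i → i =ᶠ a ∧ i =ᶠ b)     ≡⟨ count-∨∧ m (_=ᶠ a) (_=ᶠ b) ⟩
      count m (_=ᶠ a) + count m (_=ᶠ b)                     ≡⟨ cong₂ _+_ (count-=ᶠ m a) (count-=ᶠ m b) ⟩
      2                                                     ∎
      where
      a-and-b : ∀ i → (i =ᶠ a ∧ i =ᶠ b) ≡ false
      a-and-b i = ¬-not λ both →
        a≢b (trans (sym (=ᶠ-sound i a (∧-conicalˡ _ _ both))) (=ᶠ-sound i b (∧-conicalʳ (i =ᶠ a) _ both)))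

forb-oneSided : ∀ m r p′ → (∀ a b → a ≢ b → p′ ≤ countL (special a b) (columns m r)) →
  IsForb m r (pCopies01 (suc p′)) (countL oneSided (columns m r) + p′ * m * (m ∸ 1))
forb-oneSided m r p′ enough = lowerBound m r p′ enough , λ n A simple avoid → upperBound p′ A simple avoid

corollary5p2 : (r p m : ℕ) → 2 ≤ r → 1 ≤ p → 2 ≤ m →
    p ∸ 1 ≤ (r ∸ 2) ^ (m ∸ 2) →
    IsForb m r (pCopies01 p)
      (2 * (r ∸ 1) ^ m ∸ (r ∸ 2) ^ m + (p ∸ 1) * m * (m ∸ 1))
corollary5p2 (suc (suc k)) (suc p′) m (s≤s (s≤s z≤n)) (s≤s z≤n) _ p′≤ =
  subst (λ N → IsForb m (2 + k) (pCopies01 (suc p′)) (N + p′ * m * (m ∸ 1))) (countL-oneSided k m)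
    (forb-oneSided m (2 + k) p′ λ a b a≢b → subst (p′ ≤_) (sym (countL-special k m a b a≢b)) p′≤)
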